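{- Fix $k\ge2$ and let $\pi$ be a permutation containing a decreasing subsequence of length $k$, with B-sequence $b_k\cdots b_1$. If $\ell(b_k)=k$, then the A-sequence and the B-sequence of $\pi$ coincide.
   Context: Letters of $\pi$ are identified with their values. The A-sequence is the lexicographically smallest (as a sequence of values read left to right) decreasing subsequence of length $k$. The B-sequence $b_k\cdots b_1$ is defined recursively: $b_1$ is the leftmost letter that is the last letter of a decreasing subsequence of length $k$, and for $j\ge2$, $b_j$ is the leftmost letter such that $b_j\cdots b_1$ is a suffix of a decreasing subsequence of length $k$. The label $\ell(x)$ of a letter $x$ is the maximal length of a decreasing subsequence of $\pi$ starting at $x$. -}

module Defs where

open import Data.Nat using (ℕ; zero; suc; _≤_)
open import Data.Fin using (Fin; zero; suc; _<_) renaming (_≤_ to _≤ꟳ_)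
open import Data.Sum using (_⊎_)
open import Data.Product using (Σ; Σ-syntax; _×_; ∃)
open import Data.Empty using (⊥)
open import Relation.Binary.PropositionalEquality using (_≡_)
open import Function.Definitions using (Injective)

-- A permutation of [n] in one-line notation: position i ↦ letter π i.
-- Letters are identified with their values.
IsPerm : {n : ℕ} → (Fin n → Fin n) → Set
IsPerm π = Injective _≡_ _≡_ π

IsDecSubseq : {n m : ℕ} → (Fin n → Fin n) → (Fin m → Fin n) → Set
IsDecSubseq π q = ∀ i j → i < j → (q i < q j) × (π (q j) < π (q i))

HasDec : {n : ℕ} → (Fin n → Fin n) → ℕ → Set
HasDec {n} π k = Σ[ q ∈ (Fin k → Fin n) ] IsDecSubseq π q

LexLe : {n k : ℕ} → (Fin k → Fin n) → (Fin k → Fin n) → Set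
LexLe {n} {k} u v =
  (∀ i → u i ≡ v i) ⊎ (Σ[ i ∈ Fin k ] ((∀ j → j < i → u j ≡ v j) × (u i < v i)))

IsASeq : {n k : ℕ} → (Fin n → Fin n) → (Fin k → Fin n) → Set
IsASeq {n} {k} π a =
  IsDecSubseq π a ×
  (∀ (q : Fin k → Fin n) → IsDecSubseq π q → LexLe (λ i → π (a i)) (λ i → π (q i)))

-- The B-sequence b_k ⋯ b_1 is stored left to right as b : Fin k → Fin n
-- (positions), so b_j is b at index k - j (b_1 is the last entry).
-- "x b_{j-1} ⋯ b_1 is a suffix of a decreasing subsequence of length k" with
-- x at index i means: some decreasing q of length k has q i = x and agrees with
-- b at all indices after i.
SuffixOK : {n k : ℕ} → (Fin n → Fin n) → (Fin k → Fin n) → Fin k → Fin n → Set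
SuffixOK {n} {k} π b i x =
  Σ[ q ∈ (Fin k → Fin n) ] IsDecSubseq π q × (q i ≡ x) × (∀ m → i < m → q m ≡ b m)

IsBSeq : {n k : ℕ} → (Fin n → Fin n) → (Fin k → Fin n) → Set
IsBSeq {n} {k} π b =
  ∀ (i : Fin k) → SuffixOK π b i (b i) × (∀ (x : Fin n) → SuffixOK π b i x → b i ≤ꟳ x)

DecFrom : {n : ℕ} → (Fin n → Fin n) → Fin n → ℕ → Set
DecFrom π x zero = ⊥
DecFrom {n} π x (suc m) = Σ[ q ∈ (Fin (suc m) → Fin n) ] IsDecSubseq π q × (q zero ≡ x)

LabelIs : {n : ℕ} → (Fin n → Fin n) → Fin n → ℕ → Set
LabelIs π x m = DecFrom π x m × (∀ m' → DecFrom π x m' → m' ≤ m)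

module Submission where

-- Index b and every decreasing subsequence q of length k from the left, so b₀ = b_k.
-- No q crosses b: bₘ is never left of and above qₘ, for then b₀ ⋯ bₘ qₘ ⋯ q_{k-1} would
-- be decreasing of length k + 1 from b₀, against ℓ(b₀) = k.  Downward induction on j then
-- shows that bⱼ is weakly left of qⱼ: if qⱼ were left of bⱼ, either qⱼ lies above every
-- later bₘ, and q₀ ⋯ qⱼ bⱼ₊₁ ⋯ b_{k-1} contradicts the leftmost choice of bⱼ, or some
-- later bₘ lies above qⱼ > qₘ, and bₘ, being weakly left of qₘ, crosses q.  At the first
-- index where b and q differ, bᵢ is therefore left of qᵢ and, having no crossing, below it.

open import Defs
open import Data.Nat using (ℕ; _≤_)
open import Data.Fin using (Fin; fromℕ<)
open import Data.Nat.Properties using (≤-trans; n≤1+n)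

open import Data.Nat using (zero; suc; _∸_; _+_; s≤s; z<s; s<s)
import Data.Nat.Properties as ℕ
open import Data.Fin using (zero; suc; toℕ; _<_) renaming (_≤_ to _≤ᶠ_)
open import Data.Fin.Properties
  using (_≟_; _≤?_; _<?_; any?; toℕ≤n; toℕ-injective; ≤∧≢⇒<)
open import Data.Fin.Induction using (>-wellFounded)
open import Data.Vec.Functional using (_∷_; tail)
open import Data.Product using (Σ; _×_; _,_; proj₁; proj₂)
open import Data.Sum using (_⊎_; inj₁; inj₂)
open import Data.Empty using (⊥-elim)
open import Function using (_∘_)
open import Induction.WellFounded using (module All)
open import Level using (0ℓ)
open import Relation.Binary.Definitions using (Transitive; DecidableEquality)
open import Relation.Binary.PropositionalEquality
  using (_≡_; _≢_; refl; sym; trans; cong; subst; subst₂)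
open import Relation.Nullary using (¬_; yes; no)
open import Relation.Nullary.Decidable using (_×-dec_)

first-difference : ∀ {A : Set} {k} → DecidableEquality A → (u v : Fin k → A) →
  (∀ i → u i ≡ v i) ⊎ Σ (Fin k) (λ i → (∀ j → j < i → u j ≡ v j) × u i ≢ v i)
first-difference {k = zero} _≟ᴬ_ u v = inj₁ λ ()
first-difference {k = suc k} _≟ᴬ_ u v with u zero ≟ᴬ v zero
... | no u₀≢v₀ = inj₂ (zero , (λ _ ()) , u₀≢v₀)
... | yes u₀≡v₀ with first-difference _≟ᴬ_ (tail u) (tail v)
...   | inj₁ agree = inj₁ λ { zero → u₀≡v₀ ; (suc i) → agree i }
...   | inj₂ (i , agree , differ) =
        inj₂ (suc i , (λ { zero _ → u₀≡v₀ ; (suc j) (s<s j<i) → agree j j<i }) , differ)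

splice : ∀ {A : Set} {k} → Fin k → (Fin k → A) → (Fin k → A) → Fin k → A
splice j u v i with i ≤? j
... | yes _ = u i
... | no _ = v i

module _ {A : Set} {k} {j i : Fin k} {u v : Fin k → A} where

  splice-≤ : i ≤ᶠ j → splice j u v i ≡ u i
  splice-≤ i≤j with i ≤? j
  ... | yes _ = refl
  ... | no i≰j = ⊥-elim (i≰j i≤j)

  splice-> : j < i → splice j u v i ≡ v i
  splice-> j<i with i ≤? j
  ... | yes i≤j = ⊥-elim (ℕ.<⇒≱ j<i i≤j)
  ... | no _ = refl

module Decreasing {n : ℕ} (π : Fin n → Fin n) where

  infix 4 _⋖_
  _⋖_ : Fin n → Fin n → Set
  x ⋖ y = x < y × π y < π x

  ⋖-trans : Transitive _⋖_
  ⋖-trans (x<y , πy<πx) (y<z , πz<πy) = ℕ.<-trans x<y y<z , ℕ.<-trans πz<πy πy<πx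

  IsDecSubseq-tail : ∀ {k} {q : Fin (suc k) → Fin n} →
                     IsDecSubseq π q → IsDecSubseq π (tail q)
  IsDecSubseq-tail dq i j i<j = dq (suc i) (suc j) (s<s i<j)

  IsDecSubseq-∷ : ∀ {k x} {q : Fin (suc k) → Fin n} →
                  x ⋖ q zero → IsDecSubseq π q → IsDecSubseq π (x ∷ q)
  IsDecSubseq-∷ x⋖q₀ dq zero (suc zero) _ = x⋖q₀
  IsDecSubseq-∷ x⋖q₀ dq zero (suc (suc j)) _ = ⋖-trans x⋖q₀ (dq zero (suc j) z<s)
  IsDecSubseq-∷ x⋖q₀ dq (suc i) (suc j) (s<s i<j) = dq i j i<j

  IsDecSubseq-splice : ∀ {k} {u v : Fin k → Fin n} j →
    IsDecSubseq π u → IsDecSubseq π v → (∀ i → j < i → u j ⋖ v i) →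
    IsDecSubseq π (splice j u v)
  IsDecSubseq-splice j du dv link i i' i<i' with i ≤? j | i' ≤? j
  ... | yes _ | yes _ = du i i' i<i'
  ... | no i≰j | yes i'≤j = ⊥-elim (ℕ.<⇒≱ (ℕ.<-trans (ℕ.≰⇒> i≰j) i<i') i'≤j)
  ... | no _ | no _ = dv i i' i<i'
  ... | yes i≤j | no i'≰j with ℕ.m≤n⇒m<n∨m≡n i≤j
  ...   | inj₁ i<j = ⋖-trans (du i j i<j) (link i' (ℕ.≰⇒> i'≰j))
  ...   | inj₂ i≡j rewrite toℕ-injective i≡j = link i' (ℕ.≰⇒> i'≰j)

  DecFrom-∷ : ∀ {x y L} → x ⋖ y → DecFrom π y L → DecFrom π x (suc L)
  DecFrom-∷ {x} {L = suc L} x⋖y (q , dq , refl) = x ∷ q , IsDecSubseq-∷ x⋖y dq , refl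

  DecFrom-suffix : ∀ {k} {q : Fin k → Fin n} →
                   IsDecSubseq π q → ∀ m → DecFrom π (q m) (k ∸ toℕ m)
  DecFrom-suffix {suc k} dq zero = _ , dq , refl
  DecFrom-suffix {suc (suc k)} dq (suc m) = DecFrom-suffix (IsDecSubseq-tail dq) m

  DecFrom-prefix : ∀ {k L} {q : Fin (suc k) → Fin n} → IsDecSubseq π q →
                   ∀ m → DecFrom π (q m) L → DecFrom π (q zero) (toℕ m + L)
  DecFrom-prefix dq zero qₘ-chain = qₘ-chain
  DecFrom-prefix {suc k} dq (suc m) qₘ-chain =
    DecFrom-∷ (dq zero (suc zero) z<s) (DecFrom-prefix (IsDecSubseq-tail dq) m qₘ-chain)

  crossing⇒DecFrom : ∀ {k} {b q : Fin (suc k) → Fin n} →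
    IsDecSubseq π b → IsDecSubseq π q → ∀ m → b m ⋖ q m → DecFrom π (b zero) (suc (suc k))
  crossing⇒DecFrom {k} db dq m bₘ⋖qₘ =
    subst (DecFrom π _) length≡
      (DecFrom-prefix db m (DecFrom-∷ bₘ⋖qₘ (DecFrom-suffix dq m)))
    where
    length≡ : toℕ m + suc (suc k ∸ toℕ m) ≡ suc (suc k)
    length≡ = trans (ℕ.+-suc (toℕ m) _) (cong suc (ℕ.m+[n∸m]≡n (toℕ≤n m)))

  IsBSeq⇒IsDecSubseq : ∀ {k} {b : Fin (suc k) → Fin n} → IsBSeq π b → IsDecSubseq π b
  IsBSeq⇒IsDecSubseq {b = b} isB with proj₁ (isB zero)
  ... | q , dq , q₀≡b₀ , qₘ≡bₘ = λ i j i<j → subst₂ _⋖_ (q≗b i) (q≗b j) (dq i j i<j)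
    where
    q≗b : ∀ i → q i ≡ b i
    q≗b zero = q₀≡b₀
    q≗b (suc i) = qₘ≡bₘ (suc i) z<s

module _ {n k : ℕ} {π : Fin n → Fin n} {b : Fin (suc k) → Fin n} (isB : IsBSeq π b)
         (ℓb₀≤k : ∀ L → DecFrom π (b zero) L → L ≤ suc k) where

  open Decreasing π

  private
    db : IsDecSubseq π b
    db = IsBSeq⇒IsDecSubseq isB

  no-crossing : ∀ {q} → IsDecSubseq π q → ∀ m → ¬ (b m ⋖ q m)
  no-crossing dq m bₘ⋖qₘ = ℕ.n≮n _ (ℓb₀≤k _ (crossing⇒DecFrom db dq m bₘ⋖qₘ))

  private
    BSeq-leftmost-step : ∀ j → (∀ {m} → j < m → ∀ {q} → IsDecSubseq π q → b m ≤ᶠ q m) →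
                         ∀ {q} → IsDecSubseq π q → b j ≤ᶠ q j
    BSeq-leftmost-step j IH {q} dq with b j ≤? q j
    ... | yes bⱼ≤qⱼ = bⱼ≤qⱼ
    ... | no bⱼ≰qⱼ with any? (λ m → (j <? m) ×-dec (π (q j) ≤? π (b m)))
    ...   | yes (m , j<m , πqⱼ≤πbₘ) = ⊥-elim (no-crossing dq m (bₘ<qₘ , πqₘ<πbₘ))
      where
      πqₘ<πbₘ : π (q m) < π (b m)
      πqₘ<πbₘ = ℕ.<-≤-trans (proj₂ (dq j m j<m)) πqⱼ≤πbₘ
      bₘ<qₘ : b m < q m
      bₘ<qₘ = ≤∧≢⇒< (IH j<m dq) λ bₘ≡qₘ → ℕ.<-irrefl (cong (toℕ ∘ π) (sym bₘ≡qₘ)) πqₘ<πbₘ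
    ...   | no no-later-above = ⊥-elim (bⱼ≰qⱼ (proj₂ (isB j) (q j) qⱼ-continues-b))
      where
      link : ∀ m → j < m → q j ⋖ b m
      link m j<m = ℕ.<-trans (ℕ.≰⇒> bⱼ≰qⱼ) (proj₁ (db j m j<m))
                 , ℕ.≰⇒> λ πqⱼ≤πbₘ → no-later-above (m , j<m , πqⱼ≤πbₘ)
      qⱼ-continues-b : SuffixOK π b j (q j)
      qⱼ-continues-b = splice j q b , IsDecSubseq-splice j dq db link
                     , splice-≤ (ℕ.≤-refl {toℕ j}) , λ m j<m → splice-> j<m

  BSeq-leftmost : ∀ j {q} → IsDecSubseq π q → b j ≤ᶠ q j
  BSeq-leftmost = All.wfRec >-wellFounded 0ℓ
    (λ j → ∀ {q} → IsDecSubseq π q → b j ≤ᶠ q j) BSeq-leftmost-step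

  IsBSeq⇒IsASeq : IsPerm π → IsASeq π b
  IsBSeq⇒IsASeq π-injective = db , lex-minimal
    where
    lex-minimal : ∀ q → IsDecSubseq π q → LexLe (λ i → π (b i)) (λ i → π (q i))
    lex-minimal q dq with first-difference _≟_ b q
    ... | inj₁ b≗q = inj₁ (cong π ∘ b≗q)
    ... | inj₂ (i , agree , bᵢ≢qᵢ) = inj₂ (i , (λ j j<i → cong π (agree j j<i)) , πbᵢ<πqᵢ)
      where
      bᵢ<qᵢ : b i < q i
      bᵢ<qᵢ = ≤∧≢⇒< (BSeq-leftmost i dq) bᵢ≢qᵢ
      πbᵢ<πqᵢ : π (b i) < π (q i)
      πbᵢ<πqᵢ = ≤∧≢⇒< (ℕ.≮⇒≥ (no-crossing dq i ∘ (bᵢ<qᵢ ,_))) (bᵢ≢qᵢ ∘ π-injective)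

lemma23 : (n k : ℕ) → (k≥2 : 2 ≤ k) → (π : Fin n → Fin n) → IsPerm π →
          HasDec π k → (b : Fin k → Fin n) → IsBSeq π b →
          LabelIs π (b (fromℕ< (≤-trans (n≤1+n 1) k≥2))) k →
          IsASeq π b
lemma23 n .(suc (suc _)) (s≤s (s≤s _)) π π-injective _ b isB (_ , ℓb₀≤k) =
  IsBSeq⇒IsASeq isB ℓb₀≤k π-injective
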